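{- Let $n\ge 3$ be an integer and let $H$ be any graph of order $n'\ge 2$. Then: (i) if $n\equiv 0\pmod 2$, then $\gamma_{\rm sp}(P_n\Box H)=\frac{nn'}{2}$; (ii) if $n\equiv 1\pmod 2$, then $\frac{nn'}{2}\le\gamma_{\rm sp}(P_n\Box H)\le\frac{(n+1)n'}{2}$; (iii) if $n\equiv 0\pmod 4$, then $\gamma_{\rm sp}(C_n\Box H)=\frac{nn'}{2}$; (iv) if $n\equiv 1,3\pmod 4$, then $\frac{nn'}{2}\le\gamma_{\rm sp}(C_n\Box H)\le\frac{(n+1)n'}{2}$; (v) if $n\equiv 2\pmod 4$, then $\frac{nn'}{2}\le\gamma_{\rm sp}(C_n\Box H)\le\frac{(n+2)n'}{2}$.
   Context: All graphs are finite, simple and undirected. $P_n$ and $C_n$ denote the path and the cycle on $n$ vertices. For a vertex $v$, $N(v)$ is its set of neighbours; for $D\subseteq V(G)$, $\overline{D}=V(G)\setminus D$. A set $D\subseteq V(G)$ is a super dominating set of $G$ if for every $u\in\overline{D}$ there exists $v\in D$ such that $N(v)\cap\overline{D}=\{u\}$; the super domination number $\gamma_{\rm sp}(G)$ is the minimum cardinality of a super dominating set of $G$. The Cartesian product $G\Box H$ has vertex set $V(G)\times V(H)$, with $(g,h)$ adjacent to $(g',h')$ iff either $g=g'$ and $hh'\in E(H)$, or $gg'\in E(G)$ and $h=h'$. -}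

module Defs where

open import Data.Bool using (Bool; true; false; _∨_; _∧_)
open import Data.Nat using (ℕ; zero; suc; _≡ᵇ_; _∸_)
open import Data.Fin using (Fin; toℕ; remQuot)
open import Data.Fin.Subset using (Subset; _∈_; _∉_; ∣_∣)
open import Data.Product using (Σ; _×_; _,_; ∃)
open import Relation.Binary.PropositionalEquality using (_≡_)
open import Data.Nat using (_≤_; _*_)

record Graph : Set where
  field
    order  : ℕ
    adj    : Fin order → Fin order → Bool
    sym    : ∀ u v → adj u v ≡ adj v u
    irrefl : ∀ v → adj v v ≡ false
open Graph public

pathAdj : ∀ n → Fin n → Fin n → Bool
pathAdj n i j = (suc (toℕ i) ≡ᵇ toℕ j) ∨ (suc (toℕ j) ≡ᵇ toℕ i)

cycleAdj : ∀ n → Fin n → Fin n → Bool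
cycleAdj n i j = pathAdj n i j
  ∨ ((toℕ i ≡ᵇ 0) ∧ (toℕ j ≡ᵇ (n ∸ 1)))
  ∨ ((toℕ j ≡ᵇ 0) ∧ (toℕ i ≡ᵇ (n ∸ 1)))

-- The Cartesian product adjacency on Fin (m * k) ≅ Fin m × Fin k.
boxAdj : ∀ m k → (Fin m → Fin m → Bool) → (Fin k → Fin k → Bool)
       → Fin (m * k) → Fin (m * k) → Bool
boxAdj m k a b x y with remQuot {m} k x | remQuot {m} k y
... | (g , h) | (g' , h') =
  ((toℕ g ≡ᵇ toℕ g') ∧ b h h') ∨ (a g g' ∧ (toℕ h ≡ᵇ toℕ h'))

IsSuperDominating : (N : ℕ) → (Fin N → Fin N → Bool) → Subset N → Set
IsSuperDominating N a D =
  ∀ u → u ∉ D →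
    Σ (Fin N) λ v → v ∈ D × a v u ≡ true ×
      (∀ w → w ∉ D → a v w ≡ true → w ≡ u)

SuperDominationNumber : (N : ℕ) → (Fin N → Fin N → Bool) → ℕ → Set
SuperDominationNumber N a k =
  (Σ (Subset N) λ D → IsSuperDominating N a D × ∣ D ∣ ≡ k)
  × (∀ D → IsSuperDominating N a D → k ≤ ∣ D ∣)

γsp-PathBox : ℕ → Graph → ℕ → Set
γsp-PathBox n H k =
  SuperDominationNumber (n * order H) (boxAdj n (order H) (pathAdj n) (adj H)) k

γsp-CycleBox : ℕ → Graph → ℕ → Set
γsp-CycleBox n H k =
  SuperDominationNumber (n * order H) (boxAdj n (order H) (cycleAdj n) (adj H)) k

-- Lower bound: if D is super dominating, sending each u ∉ D to a vertex v ∈ D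
-- with N(v) ∖ D = {u} is injective, so |V ∖ D| ≤ |D|.
-- Upper bound: if S is super dominating in G, then S × V(H) is super
-- dominating in G □ H (the private neighbour of (g, h) is (v, h), where v is
-- that of g), and it has |S| · |V(H)| vertices.  In P_n and C_n take for S the
-- vertices ≡ 0, 3 (mod 4), plus the last vertex for odd paths and for cycles:
-- a vertex ≡ 1 (resp. 2) outside S has its left (resp. right) neighbour in S,
-- whose other neighbour is again in S.
module Submission where

open import Data.Bool using (Bool; true; false; _∨_; _∧_)
open import Data.Bool.Properties using (T-≡; ∨-zeroʳ; ∨-identityʳ; not-¬)
open import Data.Empty using (⊥-elim)
open import Data.Fin using (Fin; zero; suc; toℕ; fromℕ<; combine; remQuot)
open import Data.Fin.Properties using (toℕ-injective; toℕ-fromℕ<; toℕ<n; remQuot-combine; combine-surjective)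
open import Data.Fin.Subset using (Subset; inside; outside; _∈_; _∉_; ∣_∣; ∁; _-_; _⊂_; ⁅_⁆)
open import Data.Fin.Subset.Properties using (∣⊥∣≡0; ∣⊤∣≡n; ∣∁p∣≡n∸∣p∣; p─⊥≡p; p─q⊆p; x∈∁p⇒x∉p; x∈p∧x≢y⇒x∈p-y; x∈p⇒p-x⊂p; x∈p⇒∣p-x∣<∣p∣; nonempty?; Empty-unique)
open import Data.Fin.Subset.Induction using (⊂-wellFounded)
open import Data.Nat using (ℕ; zero; suc; _+_; _*_; _∸_; _≤_; _<_; _%_; _/_; _≡ᵇ_; z≤n; s≤s)
open import Data.Nat.Properties
open import Data.Nat.DivMod using (m*n/n≡m)
open import Data.Product using (Σ; ∃-syntax; _×_; _,_; proj₁; proj₂)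
open import Data.Sum using (_⊎_; inj₁; inj₂; [_,_]′)
open import Data.Vec using ([]; _∷_; here; there; _++_; concat; map; replicate; tabulate; lookup)
open import Data.Vec.Properties using (lookup-concat; lookup-map; lookup-replicate; lookup∘tabulate; []=⇒lookup; lookup⇒[]=)
open import Function using (_∘_)
open import Function.Bundles using (Equivalence)
open import Induction.WellFounded using (Acc; acc)
open import Relation.Nullary using (yes; no; contradiction)
open import Relation.Binary.PropositionalEquality
open import Defs hiding (sym)

∨≡true : ∀ {x y} → x ∨ y ≡ true → x ≡ true ⊎ y ≡ true
∨≡true {true}  _ = inj₁ refl
∨≡true {false} e = inj₂ e

∧≡true : ∀ {x y} → x ∧ y ≡ true → x ≡ true × y ≡ true
∧≡true {true} e = refl , e

⊆-false : ∀ {P Q : ℕ → Bool} → (∀ g → P g ≡ true → Q g ≡ true) → ∀ g → Q g ≡ false → P g ≡ false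
⊆-false {P} P⊆Q g Qg with P g in Pg
... | true  = ⊥-elim (not-¬ (P⊆Q g Pg) Qg)
... | false = refl

≡ᵇ≡true⇒≡ : ∀ {m n} → (m ≡ᵇ n) ≡ true → m ≡ n
≡ᵇ≡true⇒≡ {m} {n} e = ≡ᵇ⇒≡ m n (Equivalence.from T-≡ e)

≡ᵇ-refl : ∀ m → (m ≡ᵇ m) ≡ true
≡ᵇ-refl m = Equivalence.to T-≡ (≡⇒≡ᵇ m m refl)

x∉p-x : ∀ {n} {p : Subset n} {x} → x ∉ p - x
x∉p-x {p = _ ∷ _} {zero}  ()
x∉p-x {p = _ ∷ p} {suc x} (there x∈p-x) = x∉p-x {p = p} x∈p-x

x∈p⇒∣p∣≡1+∣p-x∣ : ∀ {n} {p : Subset n} {x} → x ∈ p → ∣ p ∣ ≡ suc ∣ p - x ∣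
x∈p⇒∣p∣≡1+∣p-x∣ {p = inside  ∷ p} here        = cong (suc ∘ ∣_∣) (sym (p─⊥≡p p))
x∈p⇒∣p∣≡1+∣p-x∣ {p = inside  ∷ p} (there x∈p) = cong suc (x∈p⇒∣p∣≡1+∣p-x∣ x∈p)
x∈p⇒∣p∣≡1+∣p-x∣ {p = outside ∷ p} (there x∈p) = x∈p⇒∣p∣≡1+∣p-x∣ x∈p

injectiveRel⇒∣p∣≤∣q∣ : ∀ {n} (R : Fin n → Fin n → Set) {p q : Subset n} →
  (∀ {x} → x ∈ p → ∃[ y ] y ∈ q × R x y) →
  (∀ {x x′ y} → x ∈ p → x′ ∈ p → R x y → R x′ y → x ≡ x′) →
  ∣ p ∣ ≤ ∣ q ∣
injectiveRel⇒∣p∣≤∣q∣ {n} R {p} = go p (⊂-wellFounded p)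
  where
  go : ∀ p {q} → Acc _⊂_ p →
    (∀ {x} → x ∈ p → ∃[ y ] y ∈ q × R x y) →
    (∀ {x x′ y} → x ∈ p → x′ ∈ p → R x y → R x′ y → x ≡ x′) →
    ∣ p ∣ ≤ ∣ q ∣
  go p {q} (acc rec) match inj with nonempty? p
  ... | no p-empty = ≤-trans (≤-reflexive (trans (cong ∣_∣ (Empty-unique p-empty)) (∣⊥∣≡0 n))) z≤n
  ... | yes (x , x∈p) with match x∈p
  ... | y , y∈q , Rxy = begin
      ∣ p ∣          ≡⟨ x∈p⇒∣p∣≡1+∣p-x∣ x∈p ⟩
      suc ∣ p - x ∣  ≤⟨ s≤s (go (p - x) (rec (x∈p⇒p-x⊂p x∈p)) match′ inj′) ⟩
      suc ∣ q - y ∣  ≤⟨ x∈p⇒∣p-x∣<∣p∣ y∈q ⟩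
      ∣ q ∣          ∎
    where
    open ≤-Reasoning
    p-x⊆p : ∀ {x′} → x′ ∈ p - x → x′ ∈ p
    p-x⊆p = p─q⊆p p ⁅ x ⁆
    match′ : ∀ {x′} → x′ ∈ p - x → ∃[ y′ ] y′ ∈ q - y × R x′ y′
    match′ x′∈p-x with match (p-x⊆p x′∈p-x)
    ... | y′ , y′∈q , Rx′y′ = y′ , x∈p∧x≢y⇒x∈p-y y′∈q y′≢y , Rx′y′
      where
      y′≢y : y′ ≢ y
      y′≢y refl = x∉p-x (subst (_∈ p - x) (sym (inj x∈p (p-x⊆p x′∈p-x) Rxy Rx′y′)) x′∈p-x)
    inj′ : ∀ {x₁ x₂ y′} → x₁ ∈ p - x → x₂ ∈ p - x → R x₁ y′ → R x₂ y′ → x₁ ≡ x₂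
    inj′ x₁∈ x₂∈ = inj (p-x⊆p x₁∈) (p-x⊆p x₂∈)

superDominating⇒n≤2∣D∣ : ∀ {N a D} → IsSuperDominating N a D → N ≤ 2 * ∣ D ∣
superDominating⇒n≤2∣D∣ {N} {a} {D} sd = begin
  N                    ≤⟨ m≤n+m∸n N ∣ D ∣ ⟩
  ∣ D ∣ + (N ∸ ∣ D ∣)  ≡⟨ cong (∣ D ∣ +_) (∣∁p∣≡n∸∣p∣ D) ⟨
  ∣ D ∣ + ∣ ∁ D ∣      ≤⟨ +-monoʳ-≤ ∣ D ∣ ∣∁D∣≤∣D∣ ⟩
  ∣ D ∣ + ∣ D ∣        ≡⟨ cong (∣ D ∣ +_) (+-identityʳ ∣ D ∣) ⟨
  2 * ∣ D ∣            ∎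
  where
  open ≤-Reasoning
  PrivateNeighbour : Fin N → Fin N → Set
  PrivateNeighbour u v = a v u ≡ true × (∀ w → w ∉ D → a v w ≡ true → w ≡ u)
  ∣∁D∣≤∣D∣ : ∣ ∁ D ∣ ≤ ∣ D ∣
  ∣∁D∣≤∣D∣ = injectiveRel⇒∣p∣≤∣q∣ PrivateNeighbour
    (λ u∈∁D → sd _ (x∈∁p⇒x∉p u∈∁D))
    (λ _ u′∈∁D (_ , only-u) (avu′ , _) → sym (only-u _ (x∈∁p⇒x∉p u′∈∁D) avu′))

superDominationNumber-half : ∀ {N a D} → IsSuperDominating N a D → 2 * ∣ D ∣ ≡ N →
  SuperDominationNumber N a (N / 2)
superDominationNumber-half {N} {a} {D} sd 2∣D∣≡N = (D , sd , sym N/2≡∣D∣) , minimal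
  where
  N/2≡∣D∣ : N / 2 ≡ ∣ D ∣
  N/2≡∣D∣ = trans (cong (_/ 2) (trans (sym 2∣D∣≡N) (*-comm 2 ∣ D ∣))) (m*n/n≡m ∣ D ∣ 2)
  minimal : ∀ D′ → IsSuperDominating N a D′ → N / 2 ≤ ∣ D′ ∣
  minimal D′ sd′ = *-cancelˡ-≤ 2
    (subst (_≤ 2 * ∣ D′ ∣) (trans (sym 2∣D∣≡N) (cong (2 *_) (sym N/2≡∣D∣)))
      (superDominating⇒n≤2∣D∣ sd′))

superDominationNumber-bounds : ∀ {N a D k} → IsSuperDominating N a D →
  SuperDominationNumber N a k → N ≤ 2 * k × k ≤ ∣ D ∣
superDominationNumber-bounds sd ((D₀ , sd₀ , refl) , minimal) =
  superDominating⇒n≤2∣D∣ sd₀ , minimal _ sd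

_⊠_ : ∀ {m} → Subset m → (k : ℕ) → Subset (m * k)
S ⊠ k = concat (map (replicate k) S)

∣p++q∣≡∣p∣+∣q∣ : ∀ {m n} (p : Subset m) (q : Subset n) → ∣ p ++ q ∣ ≡ ∣ p ∣ + ∣ q ∣
∣p++q∣≡∣p∣+∣q∣ []            q = refl
∣p++q∣≡∣p∣+∣q∣ (inside  ∷ p) q = cong suc (∣p++q∣≡∣p∣+∣q∣ p q)
∣p++q∣≡∣p∣+∣q∣ (outside ∷ p) q = ∣p++q∣≡∣p∣+∣q∣ p q

∣S⊠k∣≡∣S∣*k : ∀ {m} (S : Subset m) k → ∣ S ⊠ k ∣ ≡ ∣ S ∣ * k
∣S⊠k∣≡∣S∣*k []            k = refl
∣S⊠k∣≡∣S∣*k (inside  ∷ S) k =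
  trans (∣p++q∣≡∣p∣+∣q∣ (replicate k inside) (S ⊠ k)) (cong₂ _+_ (∣⊤∣≡n k) (∣S⊠k∣≡∣S∣*k S k))
∣S⊠k∣≡∣S∣*k (outside ∷ S) k =
  trans (∣p++q∣≡∣p∣+∣q∣ (replicate k outside) (S ⊠ k)) (cong₂ _+_ (∣⊥∣≡0 k) (∣S⊠k∣≡∣S∣*k S k))

lookup-⊠ : ∀ {m k} (S : Subset m) g (h : Fin k) → lookup (S ⊠ k) (combine g h) ≡ lookup S g
lookup-⊠ {k = k} S g h = begin
  lookup (concat (map (replicate k) S)) (combine g h)  ≡⟨ lookup-concat (map (replicate k) S) g h ⟩
  lookup (lookup (map (replicate k) S) g) h            ≡⟨ cong (λ v → lookup v h) (lookup-map g (replicate k) S) ⟩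
  lookup (replicate k (lookup S g)) h                  ≡⟨ lookup-replicate h (lookup S g) ⟩
  lookup S g                                           ∎
  where open ≡-Reasoning

combine∈S⊠k : ∀ {m k} {S : Subset m} {g} {h : Fin k} → g ∈ S → combine g h ∈ S ⊠ k
combine∈S⊠k {S = S} {g} {h} g∈S = lookup⇒[]= _ (S ⊠ _) (trans (lookup-⊠ S g h) ([]=⇒lookup g∈S))

boxEdge : ∀ {m k} → (Fin m → Fin m → Bool) → (Fin k → Fin k → Bool) →
  Fin m × Fin k → Fin m × Fin k → Bool
boxEdge a b (g , h) (g′ , h′) = ((toℕ g ≡ᵇ toℕ g′) ∧ b h h′) ∨ (a g g′ ∧ (toℕ h ≡ᵇ toℕ h′))

boxAdj≡boxEdge∘remQuot : ∀ m k a b (x y : Fin (m * k)) →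
  boxAdj m k a b x y ≡ boxEdge a b (remQuot {m} k x) (remQuot {m} k y)
boxAdj≡boxEdge∘remQuot m k a b x y with remQuot {m} k x | remQuot {m} k y
... | _ , _ | _ , _ = refl

boxAdj-combine : ∀ {m k} (a : Fin m → Fin m → Bool) (b : Fin k → Fin k → Bool) g h g′ h′ →
  boxAdj m k a b (combine g h) (combine g′ h′) ≡
    ((toℕ g ≡ᵇ toℕ g′) ∧ b h h′) ∨ (a g g′ ∧ (toℕ h ≡ᵇ toℕ h′))
boxAdj-combine {m} {k} a b g h g′ h′ =
  trans (boxAdj≡boxEdge∘remQuot m k a b (combine g h) (combine g′ h′))
    (cong₂ (boxEdge a b) (remQuot-combine g h) (remQuot-combine g′ h′))

⊠-superDominating : ∀ {m k a} {S : Subset m} (b : Fin k → Fin k → Bool) →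
  IsSuperDominating m a S → IsSuperDominating (m * k) (boxAdj m k a b) (S ⊠ k)
⊠-superDominating {m} {k} {a} {S} b sd u u∉S⊠k with combine-surjective {m} {k} u
... | g , h , refl with sd g (u∉S⊠k ∘ combine∈S⊠k)
... | v , v∈S , avg , only-g = combine v h , combine∈S⊠k v∈S , adjacent , unique
  where
  adjacent : boxAdj m k a b (combine v h) (combine g h) ≡ true
  adjacent rewrite boxAdj-combine a b v h g h | avg | ≡ᵇ-refl (toℕ h) = ∨-zeroʳ _
  unique : ∀ w → w ∉ S ⊠ k → boxAdj m k a b (combine v h) w ≡ true → w ≡ combine g h
  unique w w∉S⊠k e with combine-surjective {m} {k} w
  ... | g′ , h′ , refl with ∨≡true (trans (sym (boxAdj-combine a b v h g′ h′)) e)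
  ... | inj₁ sameCopyOfH =
    contradiction (combine∈S⊠k (subst (_∈ S) v≡g′ v∈S)) w∉S⊠k
    where v≡g′ = toℕ-injective (≡ᵇ≡true⇒≡ (proj₁ (∧≡true sameCopyOfH)))
  ... | inj₂ sameCopyOfG with ∧≡true sameCopyOfG
  ... | avg′ , h≡ᵇh′ =
    cong₂ combine (only-g g′ (w∉S⊠k ∘ combine∈S⊠k) avg′) (sym (toℕ-injective (≡ᵇ≡true⇒≡ h≡ᵇh′)))

2∣S⊠k∣≡ : ∀ {m k s} {S : Subset m} → 2 * ∣ S ∣ ≡ s → 2 * ∣ S ⊠ k ∣ ≡ s * k
2∣S⊠k∣≡ {k = k} {s} {S} 2∣S∣≡s = begin
  2 * ∣ S ⊠ k ∣    ≡⟨ cong (2 *_) (∣S⊠k∣≡∣S∣*k S k) ⟩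
  2 * (∣ S ∣ * k)  ≡⟨ *-assoc 2 ∣ S ∣ k ⟨
  2 * ∣ S ∣ * k    ≡⟨ cong (_* k) 2∣S∣≡s ⟩
  s * k            ∎
  where open ≡-Reasoning

γsp-□-exact : ∀ {n k a} {S : Subset n} (b : Fin k → Fin k → Bool) →
  IsSuperDominating n a S → 2 * ∣ S ∣ ≡ n →
  SuperDominationNumber (n * k) (boxAdj n k a b) ((n * k) / 2)
γsp-□-exact {S = S} b sd 2∣S∣≡n =
  superDominationNumber-half (⊠-superDominating b sd) (2∣S⊠k∣≡ {S = S} 2∣S∣≡n)

γsp-□-bounds : ∀ {n k a s γ} {S : Subset n} (b : Fin k → Fin k → Bool) →
  IsSuperDominating n a S → 2 * ∣ S ∣ ≡ s →
  SuperDominationNumber (n * k) (boxAdj n k a b) γ → n * k ≤ 2 * γ × 2 * γ ≤ s * k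
γsp-□-bounds {S = S} b sd 2∣S∣≡s γsp with superDominationNumber-bounds (⊠-superDominating b sd) γsp
... | nk≤2γ , γ≤∣S⊠k∣ = nk≤2γ , ≤-trans (*-monoʳ-≤ 2 γ≤∣S⊠k∣) (≤-reflexive (2∣S⊠k∣≡ {S = S} 2∣S∣≡s))

toSubset : ∀ {n} → (ℕ → Bool) → Subset n
toSubset P = tabulate (P ∘ toℕ)

∈-toSubset : ∀ {n} {P : ℕ → Bool} {i : Fin n} → P (toℕ i) ≡ true → i ∈ toSubset P
∈-toSubset {P = P} {i} Pi = lookup⇒[]= i (toSubset P) (trans (lookup∘tabulate (P ∘ toℕ) i) Pi)

∉-toSubset : ∀ {n} {P : ℕ → Bool} {i : Fin n} → i ∉ toSubset P → P (toℕ i) ≡ false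
∉-toSubset {P = P} {i} i∉P with P (toℕ i) in Pi
... | true  = contradiction (∈-toSubset {P = P} Pi) i∉P
... | false = refl

IsSuperDominatingBelow : ℕ → (ℕ → ℕ → Bool) → (ℕ → Bool) → Set
IsSuperDominatingBelow n α P = ∀ u → u < n → P u ≡ false →
  Σ ℕ λ v → v < n × P v ≡ true × α v u ≡ true ×
    (∀ w → P w ≡ false → α v w ≡ true → w ≡ u)

superDominatingBelow⇒superDominating : ∀ {n α P} → IsSuperDominatingBelow n α P →
  IsSuperDominating n (λ i j → α (toℕ i) (toℕ j)) (toSubset P)
superDominatingBelow⇒superDominating {P = P} sd u u∉P
  with sd (toℕ u) (toℕ<n u) (∉-toSubset {P = P} u∉P)
... | v , v<n , Pv , αvu , only-u with fromℕ< v<n | toℕ-fromℕ< v<n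
... | v′ | refl = v′ , ∈-toSubset {P = P} Pv , αvu ,
  λ w w∉P αv′w → toℕ-injective (only-u (toℕ w) (∉-toSubset {P = P} w∉P) αv′w)

pathAdjℕ : ℕ → ℕ → Bool
pathAdjℕ a c = (suc a ≡ᵇ c) ∨ (suc c ≡ᵇ a)

cycleAdjℕ : ℕ → ℕ → ℕ → Bool
cycleAdjℕ n a c = pathAdjℕ a c ∨ ((a ≡ᵇ 0) ∧ (c ≡ᵇ n ∸ 1)) ∨ ((c ≡ᵇ 0) ∧ (a ≡ᵇ n ∸ 1))

pathAdjℕ-suc : ∀ a → pathAdjℕ a (suc a) ≡ true
pathAdjℕ-suc a rewrite ≡ᵇ-refl (suc a) = refl

pathAdjℕ-pred : ∀ c → pathAdjℕ (suc c) c ≡ true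
pathAdjℕ-pred c rewrite ≡ᵇ-refl (suc c) = ∨-zeroʳ _

pathAdjℕ⇒ : ∀ a c → pathAdjℕ a c ≡ true → suc a ≡ c ⊎ suc c ≡ a
pathAdjℕ⇒ a c e with ∨≡true e
... | inj₁ e′ = inj₁ (≡ᵇ≡true⇒≡ e′)
... | inj₂ e′ = inj₂ (≡ᵇ≡true⇒≡ e′)

stripe : ℕ → Bool
stripe 0 = true
stripe 1 = false
stripe 2 = false
stripe 3 = true
stripe (suc (suc (suc (suc g)))) = stripe g

-- In the first case stripe (3 + v) is the value at the left neighbour of v
-- (if any), stated without truncated subtraction.
stripe-gap : ∀ u → stripe u ≡ false →
  (∃[ v ] u ≡ suc v × stripe v ≡ true × stripe (3 + v) ≡ true)
  ⊎ (stripe (1 + u) ≡ true × stripe (2 + u) ≡ true)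
stripe-gap 0 ()
stripe-gap 1 _ = inj₁ (0 , refl , refl , refl)
stripe-gap 2 _ = inj₂ (refl , refl)
stripe-gap 3 ()
stripe-gap (suc (suc (suc (suc u)))) off with stripe-gap u off
... | inj₁ (v , refl , onv , on3+v) = inj₁ (4 + v , refl , onv , on3+v)
... | inj₂ on = inj₂ on

stripes-superDominatingBelow : ∀ n (α : ℕ → ℕ → Bool) (P : ℕ → Bool) →
  (∀ g → stripe g ≡ true → P g ≡ true) →
  (∀ v w → pathAdjℕ v w ≡ true → α v w ≡ true) →
  (∀ v w → α v w ≡ true → P w ≡ false → pathAdjℕ v w ≡ true) →
  (∀ u → suc u ≡ n → stripe n ≡ true → P u ≡ true) →
  IsSuperDominatingBelow n α P
stripes-superDominatingBelow n α P stripe⊆P path⊆α offP⇒path last∈P u u<n Pu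
  with stripe-gap u (⊆-false stripe⊆P u Pu)
... | inj₁ (v , refl , onv , on3+v) =
  v , <-trans (n<1+n v) u<n , stripe⊆P v onv , path⊆α v u (pathAdjℕ-suc v) , unique
  where
  unique : ∀ w → P w ≡ false → α v w ≡ true → w ≡ suc v
  unique w Pw αvw with pathAdjℕ⇒ v w (offP⇒path v w αvw Pw)
  ... | inj₁ v+1≡w  = sym v+1≡w
  ... | inj₂ refl   = ⊥-elim (not-¬ (stripe⊆P w on3+v) Pw)
... | inj₂ (on1+u , on2+u) =
  suc u , 1+u<n , stripe⊆P (suc u) on1+u , path⊆α (suc u) u (pathAdjℕ-pred u) , unique
  where
  1+u<n : suc u < n
  1+u<n with m≤n⇒m<n∨m≡n u<n
  ... | inj₁ 1+u<n = 1+u<n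
  ... | inj₂ refl  = ⊥-elim (not-¬ (last∈P u refl on1+u) Pu)
  unique : ∀ w → P w ≡ false → α (suc u) w ≡ true → w ≡ u
  unique w Pw αvw with pathAdjℕ⇒ (suc u) w (offP⇒path (suc u) w αvw Pw)
  ... | inj₁ refl     = ⊥-elim (not-¬ (stripe⊆P w on2+u) Pw)
  ... | inj₂ 1+w≡1+u  = suc-injective 1+w≡1+u

stripes : ∀ n → Subset n
stripes n = toSubset stripe

stripe⁺ : ℕ → ℕ → Bool
stripe⁺ n g = stripe g ∨ (suc g ≡ᵇ n)

stripes⁺ : ∀ n → Subset n
stripes⁺ n = toSubset (stripe⁺ n)

stripe⊆stripe⁺ : ∀ {n} g → stripe g ≡ true → stripe⁺ n g ≡ true
stripe⊆stripe⁺ g on rewrite on = refl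

last∈stripe⁺ : ∀ {n} u → suc u ≡ n → stripe⁺ n u ≡ true
last∈stripe⁺ u refl rewrite ≡ᵇ-refl (suc u) = ∨-zeroʳ (stripe u)

stripe⁺-pred : ∀ n → stripe⁺ n (n ∸ 1) ≡ true
stripe⁺-pred zero    = refl
stripe⁺-pred (suc m) = last∈stripe⁺ m refl

even-stripe-suc⇒stripe : ∀ m → suc m % 2 ≡ 0 → stripe (suc m) ≡ true → stripe m ≡ true
even-stripe-suc⇒stripe 0 () _
even-stripe-suc⇒stripe 1 _ ()
even-stripe-suc⇒stripe 2 () _
even-stripe-suc⇒stripe 3 _ _ = refl
even-stripe-suc⇒stripe (suc (suc (suc (suc m)))) = even-stripe-suc⇒stripe m

stripes-path : ∀ n → n % 2 ≡ 0 → IsSuperDominating n (pathAdj n) (stripes n)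
stripes-path n even = superDominatingBelow⇒superDominating
  (stripes-superDominatingBelow n pathAdjℕ stripe (λ _ on → on) (λ _ _ e → e) (λ _ _ e _ → e) last∈stripes)
  where
  last∈stripes : ∀ u → suc u ≡ n → stripe n ≡ true → stripe u ≡ true
  last∈stripes u refl = even-stripe-suc⇒stripe u even

stripes⁺-superDominatingBelow : ∀ n (α : ℕ → ℕ → Bool) →
  (∀ v w → pathAdjℕ v w ≡ true → α v w ≡ true) →
  (∀ v w → α v w ≡ true → stripe⁺ n w ≡ false → pathAdjℕ v w ≡ true) →
  IsSuperDominatingBelow n α (stripe⁺ n)
stripes⁺-superDominatingBelow n α path⊆α offP⇒path =
  stripes-superDominatingBelow n α (stripe⁺ n) (stripe⊆stripe⁺ {n}) path⊆α offP⇒path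
    (λ u 1+u≡n _ → last∈stripe⁺ u 1+u≡n)

stripes⁺-path : ∀ n → IsSuperDominating n (pathAdj n) (stripes⁺ n)
stripes⁺-path n = superDominatingBelow⇒superDominating
  (stripes⁺-superDominatingBelow n pathAdjℕ (λ _ _ e → e) (λ _ _ e _ → e))

-- Both ends of the extra edge {0, n - 1} lie in stripes⁺ n.
stripes⁺-cycle : ∀ n → IsSuperDominating n (cycleAdj n) (stripes⁺ n)
stripes⁺-cycle n = superDominatingBelow⇒superDominating
  (stripes⁺-superDominatingBelow n (cycleAdjℕ n) path⊆cycle offP⇒path)
  where
  path⊆cycle : ∀ v w → pathAdjℕ v w ≡ true → cycleAdjℕ n v w ≡ true
  path⊆cycle v w e rewrite e = refl
  offP⇒path : ∀ v w → cycleAdjℕ n v w ≡ true → stripe⁺ n w ≡ false → pathAdjℕ v w ≡ true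
  offP⇒path v w e off with ∨≡true e
  ... | inj₁ path = path
  ... | inj₂ wrap with ∨≡true wrap
  ... | inj₁ w-last = ⊥-elim (not-¬ (subst (λ x → stripe⁺ n x ≡ true) (sym w≡n-1) (stripe⁺-pred n)) off)
    where w≡n-1 = ≡ᵇ≡true⇒≡ (proj₂ (∧≡true w-last))
  ... | inj₂ w-first = ⊥-elim (not-¬ (subst (λ x → stripe⁺ n x ≡ true) (sym w≡0) refl) off)
    where w≡0 = ≡ᵇ≡true⇒≡ (proj₁ (∧≡true w-first))

∣stripes∣-even : ∀ n → n % 2 ≡ 0 → 2 * ∣ stripes n ∣ ≡ n
∣stripes∣-even 0 _ = refl
∣stripes∣-even 1 ()
∣stripes∣-even 2 _ = refl
∣stripes∣-even 3 ()
∣stripes∣-even (suc (suc (suc (suc n)))) even =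
  trans (*-distribˡ-+ 2 2 ∣ stripes n ∣) (cong (4 +_) (∣stripes∣-even n even))

∣toSubset-∨-last∣ : ∀ (Q : ℕ → Bool) m →
  ∣ toSubset {suc m} (λ g → Q g ∨ (suc g ≡ᵇ suc m)) ∣ ≡ suc ∣ toSubset {m} Q ∣
∣toSubset-∨-last∣ Q zero rewrite ∨-zeroʳ (Q 0) = refl
∣toSubset-∨-last∣ Q (suc m) rewrite ∨-identityʳ (Q 0) with Q 0 | ∣toSubset-∨-last∣ (Q ∘ suc) m
... | true  | ih = cong suc ih
... | false | ih = ih

-- 2 ∣stripes⁺ n∣ ∸ n, as a function of n % 4.
slack : ℕ → ℕ
slack 1 = 1
slack 2 = 2
slack 3 = 1
slack _ = 0

2∣stripes⁺∣≡+slack : ∀ m → 2 * ∣ stripes⁺ (suc m) ∣ ≡ suc m + slack (suc m % 4)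
2∣stripes⁺∣≡+slack m = trans (cong (2 *_) (∣toSubset-∨-last∣ stripe m)) (closedForm m)
  where
  closedForm : ∀ m → 2 * suc ∣ stripes m ∣ ≡ suc m + slack (suc m % 4)
  closedForm 0 = refl
  closedForm 1 = refl
  closedForm 2 = refl
  closedForm 3 = refl
  closedForm (suc (suc (suc (suc m)))) =
    trans (*-distribˡ-+ 2 2 (suc ∣ stripes m ∣)) (cong (4 +_) (closedForm m))

2∣stripes⁺∣≡ : ∀ m {e} → slack (suc m % 4) ≡ e → 2 * ∣ stripes⁺ (suc m) ∣ ≡ suc m + e
2∣stripes⁺∣≡ m refl = 2∣stripes⁺∣≡+slack m

odd⇒slack≡1 : ∀ n → n % 2 ≡ 1 → slack (n % 4) ≡ 1
odd⇒slack≡1 0 ()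
odd⇒slack≡1 1 _ = refl
odd⇒slack≡1 2 ()
odd⇒slack≡1 3 _ = refl
odd⇒slack≡1 (suc (suc (suc (suc n)))) = odd⇒slack≡1 n

theorem24 : (n : ℕ) → 3 ≤ n → (H : Graph) → 2 ≤ order H →
    ((n % 2 ≡ 0 → γsp-PathBox n H ((n * order H) / 2))
    × (n % 2 ≡ 1 → ∀ k → γsp-PathBox n H k →
         n * order H ≤ 2 * k × 2 * k ≤ (n + 1) * order H)
    × (n % 4 ≡ 0 → γsp-CycleBox n H ((n * order H) / 2))
    × (n % 4 ≡ 1 ⊎ n % 4 ≡ 3 → ∀ k → γsp-CycleBox n H k →
         n * order H ≤ 2 * k × 2 * k ≤ (n + 1) * order H)
    × (n % 4 ≡ 2 → ∀ k → γsp-CycleBox n H k →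
         n * order H ≤ 2 * k × 2 * k ≤ (n + 2) * order H))
theorem24 n@(suc m) _ H _ =
    (λ even → γsp-□-exact (adj H) (stripes-path n even) (∣stripes∣-even n even))
  , (λ odd _ → γsp-□-bounds (adj H) (stripes⁺-path n) (2∣stripes⁺∣≡ m (odd⇒slack≡1 n odd)))
  , (λ ≡0 → γsp-□-exact (adj H) (stripes⁺-cycle n)
              (trans (2∣stripes⁺∣≡ m (cong slack ≡0)) (+-identityʳ n)))
  , (λ ≡1∨3 _ → γsp-□-bounds (adj H) (stripes⁺-cycle n)
                  (2∣stripes⁺∣≡ m ([ cong slack , cong slack ]′ ≡1∨3)))
  , (λ ≡2 _ → γsp-□-bounds (adj H) (stripes⁺-cycle n) (2∣stripes⁺∣≡ m (cong slack ≡2)))
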